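{- For every graph $G$, $\gamma_R(G)\le 2\gamma_{w2}(G)-1$.
   Context: $G=(V,E)$ finite simple graph (with at least one vertex), $N(v)$ open neighborhood. $\gamma_R(G)$ is the minimum of $\sum_v f(v)$ over $f:V\to\{0,1,2\}$ such that every $v$ with $f(v)=0$ has a neighbor $w$ with $f(w)=2$. $\gamma_{w2}(G)$ is the minimum of $\sum_v f(v)$ over $f:V\to\{0,1,2\}$ such that $\sum_{w\in N(v)}f(w)\ge 2$ for every $v$ with $f(v)=0$. -}

module Defs where

open import Data.Nat using (ℕ; zero; suc; _+_; _*_; _≤_)
open import Data.Fin using (Fin; toℕ)
open import Data.Bool using (Bool; true; false; if_then_else_)
open import Data.Product using (Σ; ∃; _×_; _,_)
open import Data.Vec.Functional using (Vector; foldr)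
open import Relation.Binary.PropositionalEquality using (_≡_)
open import Relation.Nullary using (¬_)

Σ[_] : ∀ {n} → (Fin n → ℕ) → ℕ
Σ[_] {zero}  f = 0
Σ[_] {suc n} f = f Data.Fin.zero + Σ[_] {n} (λ i → f (Data.Fin.suc i))

record Graph (n : ℕ) : Set where
  field
    adj   : Fin n → Fin n → Bool
    sym   : ∀ u v → adj u v ≡ adj v u
    irref : ∀ v → adj v v ≡ false
open Graph public

Labeling : ℕ → Set
Labeling n = Fin n → Fin 3

val : ∀ {n} → Labeling n → Fin n → ℕ
val f v = toℕ (f v)

weight : ∀ {n} → Labeling n → ℕ
weight f = Σ[ val f ]

IsRDF : ∀ {n} → Graph n → Labeling n → Set
IsRDF G f = ∀ v → val f v ≡ 0 → ∃ λ w → adj G v w ≡ true × val f w ≡ 2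

nbrSum : ∀ {n} → Graph n → Labeling n → Fin n → ℕ
nbrSum G f v = Σ[ (λ w → if adj G v w then val f w else 0) ]

IsW2DF : ∀ {n} → Graph n → Labeling n → Set
IsW2DF G f = ∀ v → val f v ≡ 0 → 2 ≤ nbrSum G f v

IsMinWeight : ∀ {n} → (Labeling n → Set) → ℕ → Set
IsMinWeight {n} P k = (∃ λ f → P f × weight f ≡ k) × (∀ f → P f → k ≤ weight f)

IsRomanDomNumber : ∀ {n} → Graph n → ℕ → Set
IsRomanDomNumber G k = IsMinWeight (IsRDF G) k

IsW2DomNumber : ∀ {n} → Graph n → ℕ → Set
IsW2DomNumber G k = IsMinWeight (IsW2DF G) k

module Submission where

-- Let f be a minimum weak 2-dominating function (w2DF) and u a vertex with
-- f(u) ≥ 1 (one exists because G is nonempty).  "Promote" f at u: keep the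
-- zeros of f and the value f(u), and raise every other positive value to 2.
-- Pointwise the promoted labeling g satisfies g(w) + [w = u] ≤ 2·f(w), so
-- weight g + 1 ≤ 2·weight f.  Moreover g is a Roman dominating function: if
-- g(v) = 0 then f(v) = 0, so the f-weight of N(v) is at least 2; a neighbour
-- of v that g does not label 2 contributes at most [w = u] to that sum, so if
-- no neighbour had label 2 the sum would be at most 1.  Minimality of γ_R
-- then gives γ_R + 1 ≤ weight g + 1 ≤ 2·γ_w2.

open import Defs hiding (sym)
import Data.Nat as ℕ
open import Data.Nat using (ℕ; zero; suc; _+_; _*_; _≤_; z≤n; s≤s)
open import Data.Nat.Properties
  using (n≢0⇒n>0; ≤-refl; ≤-trans; +-mono-≤; *-zeroʳ; *-distribˡ-+; +-commutativeSemigroup)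
open import Algebra.Properties.CommutativeSemigroup +-commutativeSemigroup
  using (interchange)
open import Data.Fin using (Fin; _≟_)
import Data.Fin as F
open import Data.Bool using (true; false; if_then_else_)
open import Data.Product using (∃; _×_; _,_)
open import Data.Sum using (_⊎_; inj₁; inj₂)
open import Relation.Nullary using (yes; no)
open import Relation.Binary.PropositionalEquality
  using (_≡_; refl; sym; cong; cong₂; subst; module ≡-Reasoning)

Σ-ext : ∀ {m} (a b : Fin m → ℕ) → (∀ w → a w ≡ b w) → Σ[ a ] ≡ Σ[ b ]
Σ-ext {zero}  a b h = refl
Σ-ext {suc m} a b h =
  cong₂ _+_ (h F.zero) (Σ-ext (λ i → a (F.suc i)) (λ i → b (F.suc i)) (λ i → h (F.suc i)))

Σ-mono : ∀ {m} (a b : Fin m → ℕ) → (∀ w → a w ≤ b w) → Σ[ a ] ≤ Σ[ b ]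
Σ-mono {zero}  a b h = z≤n
Σ-mono {suc m} a b h =
  +-mono-≤ (h F.zero) (Σ-mono (λ i → a (F.suc i)) (λ i → b (F.suc i)) (λ i → h (F.suc i)))

Σ-+ : ∀ {m} (a b : Fin m → ℕ) → Σ[ (λ w → a w + b w) ] ≡ Σ[ a ] + Σ[ b ]
Σ-+ {zero}  a b = refl
Σ-+ {suc m} a b = begin
  a₀ + b₀ + Σ[ (λ i → a (F.suc i) + b (F.suc i)) ]
    ≡⟨ cong (a₀ + b₀ +_) (Σ-+ (λ i → a (F.suc i)) (λ i → b (F.suc i))) ⟩
  a₀ + b₀ + (Σ[ (λ i → a (F.suc i)) ] + Σ[ (λ i → b (F.suc i)) ])
    ≡⟨ interchange a₀ b₀ _ _ ⟩
  a₀ + Σ[ (λ i → a (F.suc i)) ] + (b₀ + Σ[ (λ i → b (F.suc i)) ]) ∎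
  where
  open ≡-Reasoning
  a₀ = a F.zero
  b₀ = b F.zero

Σ-scale : ∀ {m} (k : ℕ) (a : Fin m → ℕ) → Σ[ (λ w → k * a w) ] ≡ k * Σ[ a ]
Σ-scale {zero}  k a = sym (*-zeroʳ k)
Σ-scale {suc m} k a = begin
  k * a F.zero + Σ[ (λ i → k * a (F.suc i)) ]
    ≡⟨ cong (k * a F.zero +_) (Σ-scale k (λ i → a (F.suc i))) ⟩
  k * a F.zero + k * Σ[ (λ i → a (F.suc i)) ]
    ≡⟨ sym (*-distribˡ-+ k (a F.zero) _) ⟩
  k * Σ[ a ] ∎
  where open ≡-Reasoning

Σ-bound-or-witness : ∀ {m} (a b : Fin m → ℕ) (P : Fin m → Set) →
  (∀ w → P w ⊎ a w ≤ b w) → (∃ P) ⊎ (Σ[ a ] ≤ Σ[ b ])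
Σ-bound-or-witness {zero}  a b P h = inj₂ z≤n
Σ-bound-or-witness {suc m} a b P h
  with h F.zero
     | Σ-bound-or-witness (λ i → a (F.suc i)) (λ i → b (F.suc i))
                          (λ i → P (F.suc i)) (λ i → h (F.suc i))
... | inj₁ p   | _            = inj₁ (F.zero , p)
... | inj₂ _   | inj₁ (w , p) = inj₁ (F.suc w , p)
... | inj₂ a≤b | inj₂ rest≤   = inj₂ (+-mono-≤ a≤b rest≤)

Σ-positive : ∀ {m} (a : Fin m → ℕ) → 1 ≤ Σ[ a ] → ∃ λ w → 1 ≤ a w
Σ-positive {zero}  a ()
Σ-positive {suc m} a pos with a F.zero in eq
... | suc _ = F.zero , subst (1 ≤_) (sym eq) (s≤s z≤n)
... | zero with Σ-positive (λ i → a (F.suc i)) pos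
...   | w , p = F.suc w , p

indicator : ∀ {m} → Fin m → Fin m → ℕ
indicator u w with w ≟ u
... | yes _ = 1
... | no _  = 0

Σ-indicator : ∀ {m} (u : Fin m) → Σ[ indicator u ] ≡ 1
Σ-indicator {suc m} F.zero = cong suc (Σ-zero {m})
  where
  Σ-zero : ∀ {k} → Σ[ (λ (i : Fin k) → indicator F.zero (F.suc i)) ] ≡ 0
  Σ-zero {zero}  = refl
  Σ-zero {suc k} = Σ-zero {k}
Σ-indicator {suc m} (F.suc u) =
  subst (λ s → s ≡ 1) (Σ-ext (indicator u) _ shift) (Σ-indicator u)
  where
  shift : ∀ i → indicator u i ≡ indicator (F.suc u) (F.suc i)
  shift i with i ≟ u
  ... | yes refl = refl
  ... | no _     = refl

two : Fin 3
two = F.suc (F.suc F.zero)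

promote : ∀ {m} → Labeling m → Fin m → Labeling m
promote f u w with f w | w ≟ u
... | F.zero  | _     = F.zero
... | F.suc _ | yes _ = f u
... | F.suc _ | no _  = two

promote-pointwise : ∀ {m} (f : Labeling m) (u : Fin m) → 1 ≤ val f u →
  ∀ w → val (promote f u) w + indicator u w ≤ 2 * val f w
promote-pointwise f u fu≥1 w with f w in eq | w ≟ u
... | F.zero               | yes refl rewrite eq with () ← fu≥1
... | F.zero               | no _ = z≤n
... | F.suc F.zero         | yes refl rewrite eq = ≤-refl
... | F.suc (F.suc F.zero) | yes refl rewrite eq = s≤s (s≤s (s≤s z≤n))
... | F.suc F.zero         | no _ = ≤-refl
... | F.suc (F.suc F.zero) | no _ = s≤s (s≤s z≤n)

promote-weight : ∀ {m} (f : Labeling m) (u : Fin m) → 1 ≤ val f u →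
  weight (promote f u) + 1 ≤ 2 * weight f
promote-weight f u fu≥1 = begin
  weight g + 1                                ≡⟨ cong (weight g +_) (sym (Σ-indicator u)) ⟩
  weight g + Σ[ indicator u ]                 ≡⟨ sym (Σ-+ (val g) (indicator u)) ⟩
  Σ[ (λ w → val g w + indicator u w) ]        ≤⟨ Σ-mono _ _ (promote-pointwise f u fu≥1) ⟩
  Σ[ (λ w → 2 * val f w) ]                    ≡⟨ Σ-scale 2 (val f) ⟩
  2 * weight f                                ∎
  where
  open Data.Nat.Properties.≤-Reasoning
  g = promote f u

promote-zero : ∀ {m} (f : Labeling m) (u : Fin m) →
  ∀ v → val (promote f u) v ≡ 0 → val f v ≡ 0
promote-zero f u v g0 with f v in eq | v ≟ u
... | F.zero  | _ = refl
... | F.suc _ | yes refl rewrite eq with () ← g0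
... | F.suc _ | no _ with () ← g0

neighbour-term : ∀ {m} (G : Graph m) (f : Labeling m) (u v w : Fin m) →
  (adj G v w ≡ true × val (promote f u) w ≡ 2)
  ⊎ ((if adj G v w then val f w else 0) ≤ indicator u w)
neighbour-term G f u v w with adj G v w
... | false = inj₂ z≤n
... | true with f w in eq | w ≟ u
...   | F.zero               | _ = inj₂ z≤n
...   | F.suc F.zero         | yes refl rewrite eq = inj₂ ≤-refl
...   | F.suc (F.suc F.zero) | yes refl rewrite eq = inj₁ (refl , refl)
...   | F.suc _              | no _ = inj₁ (refl , refl)

promote-RDF : ∀ {m} (G : Graph m) (f : Labeling m) (u : Fin m) →
  IsW2DF G f → IsRDF G (promote f u)
promote-RDF G f u w2 v g0
  with Σ-bound-or-witness (λ w → if adj G v w then val f w else 0) (indicator u) _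
                          (neighbour-term G f u v)
... | inj₁ witness = witness
... | inj₂ sum≤ind
  with ≤-trans (w2 v (promote-zero f u v g0)) (subst (_ ≤_) (Σ-indicator u) sum≤ind)
...   | s≤s ()

-- On a nonempty graph a w2DF labels some vertex positively: either vertex 0
-- does, or its neighbourhood carries f-weight ≥ 2.
w2DF-positive : ∀ {n} (G : Graph (suc n)) (f : Labeling (suc n)) →
  IsW2DF G f → ∃ λ u → 1 ≤ val f u
w2DF-positive G f w2 with val f F.zero ℕ.≟ 0
... | no f0≢0 = F.zero , n≢0⇒n>0 f0≢0
... | yes f0≡0 with Σ-positive _ (≤-trans (s≤s z≤n) (w2 F.zero f0≡0))
...   | w , pos = w , term≤val w pos
  where
  term≤val : ∀ w → 1 ≤ (if adj G F.zero w then val f w else 0) → 1 ≤ val f w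
  term≤val w p with adj G F.zero w
  ... | true = p

mainTheorem12 : (n : ℕ) (G : Graph (suc n)) (γR γw2 : ℕ) →
    IsRomanDomNumber G γR → IsW2DomNumber G γw2 → γR + 1 ≤ 2 * γw2
mainTheorem12 n G γR γw2 (_ , γR-minimal) ((f , w2 , refl) , _)
  with w2DF-positive G f w2
... | u , fu≥1 =
  ≤-trans (+-mono-≤ (γR-minimal (promote f u) (promote-RDF G f u w2)) ≤-refl)
          (promote-weight f u fu≥1)
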